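{- For all integers $a,b\ge0$ there is a bijection $g:\mathcal Y_{a,b}\rightarrow\mathcal Y_{a,b}$ such that for every $P\in\mathcal Y_{a,b}$, $$\mathrm{Peak}(P)=\mathrm{hd}(g(P)) \quad \text{and}\quad \mathrm{Peak}^*(P)=\mathrm{hd}^*(g(P)).$$
   Context: $\mathcal Y_{a,b}$ is the set of lattice paths with unit steps $N$ and $E$ from $(0,0)$ to $(b,a)$; each such path is identified with the Young diagram fitting inside an $a\times b$ rectangle (diagram justified to the upper-left corner) whose southeast boundary is the path. Let $n=a+b$ and label the vertices of a path $0,1,\dots,n$ starting from the origin. A peak is an occurrence of consecutive steps $NE$, identified with the vertex between them; $\mathrm{Peak}(P)$ is the set of labels of peak vertices. $\mathrm{Peak}^*(P)=\mathrm{Peak}(P)\cup\{n\}$ if $P$ ends with an $N$ step, and $\mathrm{Peak}^*(P)=\mathrm{Peak}(P)$ otherwise. The hook decomposition $\mathrm{hd}(P)=\{i_1,\dots,i_k\}$ of the Young diagram $\lambda$ of $P$: $k$ is the side of the Durfee square of $\lambda$ (the largest $k$ with $\lambda_k\ge k$); $i_k$ is the number of boxes in the hook formed by the first row and first column of $\lambda$; after removing this hook, $i_{k-1}$ is the number of boxes of the largest hook of the remaining diagram, and so on recursively. $\mathrm{hd}^*(P)=\mathrm{hd}(P)\cup\{n\}$ if $P$ begins with an $N$ step, and $\mathrm{hd}^*(P)=\mathrm{hd}(P)$ otherwise. -}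

module Defs where

open import Data.Nat using (ℕ; zero; suc; _+_; _∸_; _≤?_)
open import Data.List using (List; []; _∷_; length; reverse; map; filter; last; head)
open import Data.List.Membership.Propositional using (_∈_)
open import Data.Maybe using (Maybe; just; nothing)
open import Data.Product using (Σ; _×_)
open import Relation.Binary.PropositionalEquality using (_≡_)
open import Function.Bundles using (_⇔_)

data Step : Set where
  N E : Step

countN countE : List Step → ℕ
countN []       = 0
countN (N ∷ s)  = suc (countN s)
countN (E ∷ s)  = countN s
countE []       = 0
countE (E ∷ s)  = suc (countE s)
countE (N ∷ s)  = countE s

Y : ℕ → ℕ → Set
Y a b = Σ (List Step) (λ p → (countN p ≡ a) × (countE p ≡ b))

-- vertices labelled 0..n from the origin; `peaksFrom j s` : j is the label of the
-- vertex where the remaining steps s start.  A peak is a factor N E, labelled by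
-- the vertex between the two steps.
peaksFrom : ℕ → List Step → List ℕ
peaksFrom j []            = []
peaksFrom j (N ∷ E ∷ s)   = suc j ∷ peaksFrom (suc j) (E ∷ s)
peaksFrom j (N ∷ [])      = []
peaksFrom j (N ∷ N ∷ s)   = peaksFrom (suc j) (N ∷ s)
peaksFrom j (E ∷ s)       = peaksFrom (suc j) s

Peak : List Step → List ℕ
Peak p = peaksFrom 0 p

endsWithN : List Step → Set
endsWithN p = last p ≡ just N

beginsWithN : List Step → Set
beginsWithN p = head p ≡ just N

_∈Peak*_ : ℕ → List Step → Set
i ∈Peak* p = (i ∈ Peak p) Data.Sum.⊎ ((i ≡ length p) × endsWithN p)
  where import Data.Sum

-- Young diagram of a path: the diagram sits in the upper-left corner of the
-- a×b rectangle with the path as southeast boundary. The row at height between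
-- y and y+1 (counted from the bottom) has length = number of E steps before the
-- (y+1)-th N step. Rows listed bottom-up, then reversed to get λ₁ ≥ λ₂ ≥ …
rowsBottomUp : ℕ → List Step → List ℕ
rowsBottomUp e []      = []
rowsBottomUp e (E ∷ s) = rowsBottomUp (suc e) s
rowsBottomUp e (N ∷ s) = e ∷ rowsBottomUp e s

shape : List Step → List ℕ
shape p = reverse (rowsBottomUp 0 p)

colLength : List ℕ → ℕ
colLength []            = 0
colLength (zero ∷ l)    = colLength l
colLength (suc x ∷ l)   = suc (colLength l)

-- hook decomposition of a partition (parts weakly decreasing), listed from the
-- largest hook (i_k) down: while the diagram is nonempty, record the size of the
-- hook of the first row and first column, remove that hook, and recurse.
-- (The number of recorded hooks is the Durfee square side k.)
-- `hooksAux d l`: the current diagram is `map (_∸ d) l` (d hooks already removed).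
hooksAux : ℕ → List ℕ → List ℕ
hooksAux d []      = []
hooksAux d (x ∷ l) with x ∸ d
... | zero  = []
... | suc y = (suc y + colLength (map (λ r → r ∸ d) l)) ∷ hooksAux (suc d) l

hooks : List ℕ → List ℕ
hooks l = hooksAux 0 l

hd : List Step → List ℕ
hd p = hooks (shape p)

_∈hd*_ : ℕ → List Step → Set
i ∈hd* p = (i ∈ hd p) Data.Sum.⊎ ((i ≡ length p) × beginsWithN p)
  where import Data.Sum

_≐_ : List ℕ → List ℕ → Set
xs ≐ ys = ∀ i → (i ∈ xs) ⇔ (i ∈ ys)

-- Every path factors uniquely into blocks, one per peak:
--   P = E^{r₀} N^{s₀} · N E^{r₁+1} N^{s₁} · ⋯ · N E^{r_k+1} N^{s_k}.
-- Send it to the path Q built by nesting: Q₀ = N^{s₀} E^{r₀} and Q_j = N^{s_j} E Q_{j-1} N E^{r_j}.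
-- Appending the block N E^{r+1} N^s to a path P′ creates exactly one new peak, at |P′| + 1,
-- while wrapping Q′ into N^s E Q′ N E^r adds a new first row and first column to its Young
-- diagram, i.e. a new largest hook of size |Q′| + 1 whose removal gives back the diagram of Q′.
-- Since |P′| = |Q′|, Peak(P) = hd(Q); both P and Q determine the rᵢ, sᵢ, so P ↦ Q is a
-- bijection, and P ends with N iff s_k > 0 iff Q begins with N.
module Submission where

open import Defs
open import Data.Nat using (ℕ; zero; suc; pred; _+_; _∸_; _≤_; s≤s)
open import Data.Nat.Properties
  using (+-comm; +-suc; +-identityʳ; 0∸n≡0; n≤1+n; ≤-refl; ≤-trans; ≤-reflexive; pred-mono-≤; ≡-irrelevant)
open import Data.Nat.Tactic.RingSolver using (solve-∀)
open import Data.List using (List; []; _∷_; [_]; _++_; _∷ʳ_; length; reverse; replicate; map; last; head)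
open import Data.List.Properties
  using ( ++-identityʳ; ++-assoc; length-++; length-++-≤ˡ; length-++-≤ʳ; map-++; map-id; map-∘
        ; map-replicate; unfold-reverse; reverse-++; reverse-map; length-reverse; reverse-injective)
open import Data.List.Relation.Unary.Any.Properties using (reverse⁺; reverse⁻)
open import Data.Maybe using (just)
open import Data.Product using (Σ; _×_; _,_; proj₁)
open import Data.Sum using (_⊎_; inj₁; inj₂)
open import Function.Bundles using (_⤖_; _⇔_; Bijection; Equivalence; mk⇔; mk↔ₛ′)
open import Function.Properties.Inverse using (↔⇒⤖)
open import Relation.Binary.PropositionalEquality
  using (_≡_; refl; sym; trans; cong; cong₂; subst; module ≡-Reasoning)
open ≡-Reasoning

replicate-++-∷ : ∀ {A : Set} n (x : A) ys → replicate n x ++ x ∷ ys ≡ x ∷ replicate n x ++ ys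
replicate-++-∷ zero    x ys = refl
replicate-++-∷ (suc n) x ys = cong (x ∷_) (replicate-++-∷ n x ys)

reverse-replicate : ∀ {A : Set} n (x : A) → reverse (replicate n x) ≡ replicate n x
reverse-replicate zero    x = refl
reverse-replicate (suc n) x = begin
  reverse (x ∷ replicate n x)   ≡⟨ unfold-reverse x (replicate n x) ⟩
  reverse (replicate n x) ∷ʳ x  ≡⟨ cong (_∷ʳ x) (reverse-replicate n x) ⟩
  replicate n x ++ [ x ]        ≡⟨ replicate-++-∷ n x [] ⟩
  x ∷ replicate n x ++ []       ≡⟨ cong (x ∷_) (++-identityʳ (replicate n x)) ⟩
  x ∷ replicate n x             ∎

last-++-∷ : ∀ {A : Set} (xs : List A) y ys → last (xs ++ y ∷ ys) ≡ last (y ∷ ys)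
last-++-∷ []           y ys = refl
last-++-∷ (x ∷ [])     y ys = refl
last-++-∷ (x ∷ x′ ∷ xs) y ys = last-++-∷ (x′ ∷ xs) y ys

last-replicate : ∀ {A : Set} n (x : A) → last (x ∷ replicate n x) ≡ just x
last-replicate zero    x = refl
last-replicate (suc n) x = last-replicate n x

reverse-≐ : ∀ xs → reverse xs ≐ xs
reverse-≐ xs i = mk⇔ reverse⁻ reverse⁺

Es Ns : ℕ → List Step
Es r = replicate r E
Ns s = replicate s N

countN-++ : ∀ xs ys → countN (xs ++ ys) ≡ countN xs + countN ys
countN-++ []       ys = refl
countN-++ (N ∷ xs) ys = cong suc (countN-++ xs ys)
countN-++ (E ∷ xs) ys = countN-++ xs ys

countE-++ : ∀ xs ys → countE (xs ++ ys) ≡ countE xs + countE ys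
countE-++ []       ys = refl
countE-++ (E ∷ xs) ys = cong suc (countE-++ xs ys)
countE-++ (N ∷ xs) ys = countE-++ xs ys

length≡countN+countE : ∀ p → length p ≡ countN p + countE p
length≡countN+countE []      = refl
length≡countN+countE (N ∷ p) = cong suc (length≡countN+countE p)
length≡countN+countE (E ∷ p) = trans (cong suc (length≡countN+countE p)) (sym (+-suc (countN p) (countE p)))

-- A following N step cannot complete a peak at the end of xs, so no peak is lost at the seam.
peaksFrom-++-N : ∀ j xs w → peaksFrom j (xs ++ N ∷ w) ≡ peaksFrom j xs ++ peaksFrom (j + length xs) (N ∷ w)
peaksFrom-++-N j []           w = cong (λ k → peaksFrom k (N ∷ w)) (sym (+-identityʳ j))
peaksFrom-++-N j (E ∷ xs)     w = trans (peaksFrom-++-N (suc j) xs w)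
  (cong (λ k → peaksFrom (suc j) xs ++ peaksFrom k (N ∷ w)) (sym (+-suc j (length xs))))
peaksFrom-++-N j (N ∷ [])     w = cong (λ k → peaksFrom k (N ∷ w)) (+-comm 1 j)
peaksFrom-++-N j (N ∷ N ∷ xs) w = trans (peaksFrom-++-N (suc j) (N ∷ xs) w)
  (cong (λ k → peaksFrom (suc j) (N ∷ xs) ++ peaksFrom k (N ∷ w)) (sym (+-suc j (length (N ∷ xs)))))
peaksFrom-++-N j (N ∷ E ∷ xs) w = cong (suc j ∷_) (trans (peaksFrom-++-N (suc j) (E ∷ xs) w)
  (cong (λ k → peaksFrom (suc j) (E ∷ xs) ++ peaksFrom k (N ∷ w)) (sym (+-suc j (length (E ∷ xs))))))

peaksFrom-Ns : ∀ j s → peaksFrom j (Ns s) ≡ []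
peaksFrom-Ns j zero          = refl
peaksFrom-Ns j (suc zero)    = refl
peaksFrom-Ns j (suc (suc s)) = peaksFrom-Ns (suc j) (suc s)

peaksFrom-Es-Ns : ∀ j r s → peaksFrom j (Es r ++ Ns s) ≡ []
peaksFrom-Es-Ns j zero    s = peaksFrom-Ns j s
peaksFrom-Es-Ns j (suc r) s = peaksFrom-Es-Ns (suc j) r s

rowsBottomUp-Ns-++ : ∀ e s w → rowsBottomUp e (Ns s ++ w) ≡ replicate s e ++ rowsBottomUp e w
rowsBottomUp-Ns-++ e zero    w = refl
rowsBottomUp-Ns-++ e (suc s) w = cong (e ∷_) (rowsBottomUp-Ns-++ e s w)

rowsBottomUp-Es : ∀ e r → rowsBottomUp e (Es r) ≡ []
rowsBottomUp-Es e zero    = refl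
rowsBottomUp-Es e (suc r) = rowsBottomUp-Es (suc e) r

rowsBottomUp-++ : ∀ e q w → rowsBottomUp e (q ++ w) ≡ rowsBottomUp e q ++ rowsBottomUp (countE q + e) w
rowsBottomUp-++ e []      w = refl
rowsBottomUp-++ e (N ∷ q) w = cong (e ∷_) (rowsBottomUp-++ e q w)
rowsBottomUp-++ e (E ∷ q) w = trans (rowsBottomUp-++ (suc e) q w)
  (cong (λ k → rowsBottomUp e (E ∷ q) ++ rowsBottomUp k w) (+-suc (countE q) e))

rowsBottomUp-suc : ∀ e q → rowsBottomUp (suc e) q ≡ map suc (rowsBottomUp e q)
rowsBottomUp-suc e []      = refl
rowsBottomUp-suc e (N ∷ q) = cong (suc e ∷_) (rowsBottomUp-suc e q)
rowsBottomUp-suc e (E ∷ q) = rowsBottomUp-suc (suc e) q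

length-rowsBottomUp : ∀ e q → length (rowsBottomUp e q) ≡ countN q
length-rowsBottomUp e []      = refl
length-rowsBottomUp e (N ∷ q) = cong suc (length-rowsBottomUp e q)
length-rowsBottomUp e (E ∷ q) = length-rowsBottomUp (suc e) q

length-shape : ∀ q → length (shape q) ≡ countN q
length-shape q = trans (length-reverse (rowsBottomUp 0 q)) (length-rowsBottomUp 0 q)

shape-Ns-Es : ∀ s r → shape (Ns s ++ Es r) ≡ replicate s 0
shape-Ns-Es s r = begin
  reverse (rowsBottomUp 0 (Ns s ++ Es r))      ≡⟨ cong reverse (rowsBottomUp-Ns-++ 0 s (Es r)) ⟩
  reverse (replicate s 0 ++ rowsBottomUp 0 (Es r)) ≡⟨ cong (λ w → reverse (replicate s 0 ++ w)) (rowsBottomUp-Es 0 r) ⟩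
  reverse (replicate s 0 ++ [])                ≡⟨ cong reverse (++-identityʳ (replicate s 0)) ⟩
  reverse (replicate s 0)                      ≡⟨ reverse-replicate s 0 ⟩
  replicate s 0                                ∎

shape-wrap : ∀ s q r →
  shape (Ns s ++ E ∷ q ++ N ∷ Es r) ≡ suc (countE q) ∷ map suc (shape q) ++ replicate s 0
shape-wrap s q r = begin
  reverse (rowsBottomUp 0 (Ns s ++ E ∷ q ++ N ∷ Es r))
    ≡⟨ cong reverse (rowsBottomUp-Ns-++ 0 s (E ∷ q ++ N ∷ Es r)) ⟩
  reverse (replicate s 0 ++ rowsBottomUp 1 (q ++ N ∷ Es r))
    ≡⟨ cong (λ w → reverse (replicate s 0 ++ w)) rows ⟩
  reverse (replicate s 0 ++ map suc R ∷ʳ suc (countE q))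
    ≡⟨ reverse-++ (replicate s 0) (map suc R ∷ʳ suc (countE q)) ⟩
  reverse (map suc R ∷ʳ suc (countE q)) ++ reverse (replicate s 0)
    ≡⟨ cong₂ _++_ (reverse-++ (map suc R) [ suc (countE q) ]) (reverse-replicate s 0) ⟩
  suc (countE q) ∷ reverse (map suc R) ++ replicate s 0
    ≡⟨ cong (λ L → suc (countE q) ∷ L ++ replicate s 0) (sym (reverse-map suc R)) ⟩
  suc (countE q) ∷ map suc (reverse R) ++ replicate s 0
    ∎
  where
  R = rowsBottomUp 0 q
  rows : rowsBottomUp 1 (q ++ N ∷ Es r) ≡ map suc R ∷ʳ suc (countE q)
  rows = begin
    rowsBottomUp 1 (q ++ N ∷ Es r)
      ≡⟨ rowsBottomUp-++ 1 q (N ∷ Es r) ⟩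
    rowsBottomUp 1 q ++ countE q + 1 ∷ rowsBottomUp (countE q + 1) (Es r)
      ≡⟨ cong₂ (λ L k → L ++ k ∷ rowsBottomUp k (Es r)) (rowsBottomUp-suc 0 q) (+-comm (countE q) 1) ⟩
    map suc R ++ suc (countE q) ∷ rowsBottomUp (suc (countE q)) (Es r)
      ≡⟨ cong (λ w → map suc R ++ suc (countE q) ∷ w) (rowsBottomUp-Es (suc (countE q)) r) ⟩
    map suc R ∷ʳ suc (countE q)
      ∎

colLength-++-zeros : ∀ xs m → colLength (xs ++ replicate m 0) ≡ colLength xs
colLength-++-zeros []         zero    = refl
colLength-++-zeros []         (suc m) = colLength-++-zeros [] m
colLength-++-zeros (zero ∷ xs)  m     = colLength-++-zeros xs m
colLength-++-zeros (suc x ∷ xs) m     = cong suc (colLength-++-zeros xs m)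

colLength-map-∸-++-zeros : ∀ d xs m →
  colLength (map (_∸ d) (xs ++ replicate m 0)) ≡ colLength (map (_∸ d) xs)
colLength-map-∸-++-zeros d xs m = begin
  colLength (map (_∸ d) (xs ++ replicate m 0))
    ≡⟨ cong colLength (map-++ (_∸ d) xs (replicate m 0)) ⟩
  colLength (map (_∸ d) xs ++ map (_∸ d) (replicate m 0))
    ≡⟨ cong (λ z → colLength (map (_∸ d) xs ++ z)) (map-replicate (_∸ d) m 0) ⟩
  colLength (map (_∸ d) xs ++ replicate m (0 ∸ d))
    ≡⟨ cong (λ z → colLength (map (_∸ d) xs ++ replicate m z)) (0∸n≡0 d) ⟩
  colLength (map (_∸ d) xs ++ replicate m 0)
    ≡⟨ colLength-++-zeros (map (_∸ d) xs) m ⟩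
  colLength (map (_∸ d) xs)
    ∎

hooksAux-++-zeros : ∀ d xs m → hooksAux d (xs ++ replicate m 0) ≡ hooksAux d xs
hooksAux-++-zeros d       []       zero    = refl
hooksAux-++-zeros zero    []       (suc m) = refl
hooksAux-++-zeros (suc d) []       (suc m) = refl
hooksAux-++-zeros d       (x ∷ xs) m with x ∸ d
... | zero  = refl
... | suc y = cong₂ _∷_ (cong (suc y +_) (colLength-map-∸-++-zeros d xs m)) (hooksAux-++-zeros (suc d) xs m)

colLength-map-suc : ∀ xs → colLength (map suc xs) ≡ length xs
colLength-map-suc []       = refl
colLength-map-suc (x ∷ xs) = cong suc (colLength-map-suc xs)

hooksAux-map-suc : ∀ d xs → hooksAux (suc d) (map suc xs) ≡ hooksAux d xs
hooksAux-map-suc d []       = refl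
hooksAux-map-suc d (x ∷ xs) with x ∸ d
... | zero  = refl
... | suc y = cong₂ _∷_ (cong (λ z → suc y + colLength z) (sym (map-∘ xs))) (hooksAux-map-suc (suc d) xs)

hooks-∷-map-suc : ∀ m xs s → hooks (suc m ∷ map suc xs ++ replicate s 0) ≡ suc (m + length xs) ∷ hooks xs
hooks-∷-map-suc m xs s = cong₂ _∷_ (cong (λ k → suc (m + k)) firstColumn) remainingHooks
  where
  firstColumn : colLength (map (_∸ 0) (map suc xs ++ replicate s 0)) ≡ length xs
  firstColumn = trans (cong colLength (map-id (map suc xs ++ replicate s 0)))
    (trans (colLength-++-zeros (map suc xs) s) (colLength-map-suc xs))
  remainingHooks : hooksAux 1 (map suc xs ++ replicate s 0) ≡ hooks xs
  remainingHooks = trans (hooksAux-++-zeros 1 (map suc xs) s) (hooksAux-map-suc 0 xs)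

hd-Ns-Es : ∀ s r → hd (Ns s ++ Es r) ≡ []
hd-Ns-Es s r = trans (cong hooks (shape-Ns-Es s r)) (hooksAux-++-zeros 0 [] s)

hd-wrap : ∀ s q r → hd (Ns s ++ E ∷ q ++ N ∷ Es r) ≡ suc (length q) ∷ hd q
hd-wrap s q r = begin
  hooks (shape (Ns s ++ E ∷ q ++ N ∷ Es r))
    ≡⟨ cong hooks (shape-wrap s q r) ⟩
  hooks (suc (countE q) ∷ map suc (shape q) ++ replicate s 0)
    ≡⟨ hooks-∷-map-suc (countE q) (shape q) s ⟩
  suc (countE q + length (shape q)) ∷ hd q
    ≡⟨ cong (λ k → suc (countE q + k) ∷ hd q) (length-shape q) ⟩
  suc (countE q + countN q) ∷ hd q
    ≡⟨ cong (λ k → suc k ∷ hd q) (trans (+-comm (countE q) (countN q)) (sym (length≡countN+countE q))) ⟩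
  suc (length q) ∷ hd q
    ∎

data Code : Set where
  base   : (r s : ℕ) → Code
  extend : Code → (r s : ℕ) → Code

peakPath : Code → List Step
peakPath (base r s)     = Es r ++ Ns s
peakPath (extend c r s) = peakPath c ++ N ∷ E ∷ Es r ++ Ns s

hookPath : Code → List Step
hookPath (base r s)     = Ns s ++ Es r
hookPath (extend c r s) = Ns s ++ E ∷ hookPath c ++ N ∷ Es r

-- The two paths are rearrangements of the same steps.
module _ (μ : List Step → ℕ) (μ-++ : ∀ xs ys → μ (xs ++ ys) ≡ μ xs + μ ys) where

  additive-hookPath : ∀ c → μ (hookPath c) ≡ μ (peakPath c)
  additive-hookPath (base r s) = begin
    μ (Ns s ++ Es r)     ≡⟨ μ-++ (Ns s) (Es r) ⟩
    μ (Ns s) + μ (Es r)  ≡⟨ +-comm (μ (Ns s)) (μ (Es r)) ⟩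
    μ (Es r) + μ (Ns s)  ≡⟨ μ-++ (Es r) (Ns s) ⟨
    μ (Es r ++ Ns s)     ∎
  additive-hookPath (extend c r s) = begin
    μ (Ns s ++ [ E ] ++ hookPath c ++ [ N ] ++ Es r)
      ≡⟨ μ-++ (Ns s) _ ⟩
    μ (Ns s) + μ ([ E ] ++ hookPath c ++ [ N ] ++ Es r)
      ≡⟨ cong (μ (Ns s) +_) (trans (μ-++ [ E ] _) (cong (μ [ E ] +_) (μ-++ (hookPath c) _))) ⟩
    μ (Ns s) + (μ [ E ] + (μ (hookPath c) + μ ([ N ] ++ Es r)))
      ≡⟨ cong (λ k → μ (Ns s) + (μ [ E ] + (k + μ ([ N ] ++ Es r)))) (additive-hookPath c) ⟩
    μ (Ns s) + (μ [ E ] + (μ (peakPath c) + μ ([ N ] ++ Es r)))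
      ≡⟨ cong (λ k → μ (Ns s) + (μ [ E ] + (μ (peakPath c) + k))) (μ-++ [ N ] (Es r)) ⟩
    μ (Ns s) + (μ [ E ] + (μ (peakPath c) + (μ [ N ] + μ (Es r))))
      ≡⟨ shuffle (μ (Ns s)) (μ [ E ]) (μ (peakPath c)) (μ [ N ]) (μ (Es r)) ⟩
    μ (peakPath c) + (μ [ N ] + (μ [ E ] + (μ (Es r) + μ (Ns s))))
      ≡⟨ cong (λ k → μ (peakPath c) + (μ [ N ] + (μ [ E ] + k))) (μ-++ (Es r) (Ns s)) ⟨
    μ (peakPath c) + (μ [ N ] + (μ [ E ] + μ (Es r ++ Ns s)))
      ≡⟨ cong (μ (peakPath c) +_) (trans (μ-++ [ N ] _) (cong (μ [ N ] +_) (μ-++ [ E ] _))) ⟨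
    μ (peakPath c) + μ ([ N ] ++ [ E ] ++ Es r ++ Ns s)
      ≡⟨ μ-++ (peakPath c) _ ⟨
    μ (peakPath c ++ [ N ] ++ [ E ] ++ Es r ++ Ns s)
      ∎
    where
    shuffle : ∀ a b c d e → a + (b + (c + (d + e))) ≡ c + (d + (b + (e + a)))
    shuffle = solve-∀

length-hookPath : ∀ c → length (hookPath c) ≡ length (peakPath c)
length-hookPath = additive-hookPath length (λ xs ys → length-++ xs)

Peak-peakPath : ∀ c → Peak (peakPath c) ≡ reverse (hd (hookPath c))
Peak-peakPath (base r s) = begin
  peaksFrom 0 (Es r ++ Ns s)  ≡⟨ peaksFrom-Es-Ns 0 r s ⟩
  []                          ≡⟨ cong reverse (hd-Ns-Es s r) ⟨
  reverse (hd (Ns s ++ Es r)) ∎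
Peak-peakPath (extend c r s) = begin
  Peak (peakPath c ++ N ∷ E ∷ Es r ++ Ns s)
    ≡⟨ peaksFrom-++-N 0 (peakPath c) (E ∷ Es r ++ Ns s) ⟩
  Peak (peakPath c) ++ suc (length (peakPath c)) ∷ peaksFrom _ (Es (suc r) ++ Ns s)
    ≡⟨ cong (λ w → Peak (peakPath c) ++ suc (length (peakPath c)) ∷ w) (peaksFrom-Es-Ns _ (suc r) s) ⟩
  Peak (peakPath c) ∷ʳ suc (length (peakPath c))
    ≡⟨ cong₂ (λ xs k → xs ∷ʳ suc k) (Peak-peakPath c) (sym (length-hookPath c)) ⟩
  reverse (hd (hookPath c)) ∷ʳ suc (length (hookPath c))
    ≡⟨ unfold-reverse (suc (length (hookPath c))) (hd (hookPath c)) ⟨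
  reverse (suc (length (hookPath c)) ∷ hd (hookPath c))
    ≡⟨ cong reverse (hd-wrap s (hookPath c) r) ⟨
  reverse (hd (hookPath (extend c r s)))
    ∎

Peak≐hd : ∀ c → Peak (peakPath c) ≐ hd (hookPath c)
Peak≐hd c = subst (_≐ hd (hookPath c)) (sym (Peak-peakPath c)) (reverse-≐ (hd (hookPath c)))

-- Both sides are decided by the final run N^s alone.
last-E-Es-Ns : ∀ r s w → last (E ∷ Es r ++ Ns s) ≡ head (Ns s ++ E ∷ w)
last-E-Es-Ns r zero    w = trans (cong last (++-identityʳ (E ∷ Es r))) (last-replicate r E)
last-E-Es-Ns r (suc s) w = trans (last-++-∷ (E ∷ Es r) N (Ns s)) (last-replicate s N)

last-Ns≡head-Ns : ∀ s → last (Ns s) ≡ head (Ns s)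
last-Ns≡head-Ns zero    = refl
last-Ns≡head-Ns (suc s) = last-replicate s N

last-peakPath : ∀ c → last (peakPath c) ≡ head (hookPath c)
last-peakPath (base zero    s) = trans (last-Ns≡head-Ns s) (cong head (sym (++-identityʳ (Ns s))))
last-peakPath (base (suc r) s) = last-E-Es-Ns r s (Es r)
last-peakPath (extend c r s)   =
  trans (last-++-∷ (peakPath c) N (E ∷ Es r ++ Ns s)) (last-E-Es-Ns r s (hookPath c ++ N ∷ Es r))

peakPathʳ : Code → List Step
peakPathʳ (base r s)     = Ns s ++ Es r
peakPathʳ (extend c r s) = Ns s ++ E ∷ Es r ++ N ∷ peakPathʳ c

reverse-Es-Ns : ∀ r s → reverse (Es r ++ Ns s) ≡ Ns s ++ Es r
reverse-Es-Ns r s = trans (reverse-++ (Es r) (Ns s)) (cong₂ _++_ (reverse-replicate s N) (reverse-replicate r E))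

reverse-peakPath : ∀ c → reverse (peakPath c) ≡ peakPathʳ c
reverse-peakPath (base r s)     = reverse-Es-Ns r s
reverse-peakPath (extend c r s) = begin
  reverse (peakPath c ++ N ∷ E ∷ Es r ++ Ns s)
    ≡⟨ reverse-++ (peakPath c) (N ∷ E ∷ Es r ++ Ns s) ⟩
  reverse (N ∷ E ∷ Es r ++ Ns s) ++ reverse (peakPath c)
    ≡⟨ cong₂ _++_ (unfold-reverse N (Es (suc r) ++ Ns s)) (reverse-peakPath c) ⟩
  (reverse (Es (suc r) ++ Ns s) ∷ʳ N) ++ peakPathʳ c
    ≡⟨ cong (λ w → (w ∷ʳ N) ++ peakPathʳ c) (reverse-Es-Ns (suc r) s) ⟩
  ((Ns s ++ E ∷ Es r) ∷ʳ N) ++ peakPathʳ c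
    ≡⟨ ++-assoc (Ns s ++ E ∷ Es r) [ N ] (peakPathʳ c) ⟩
  (Ns s ++ E ∷ Es r) ++ N ∷ peakPathʳ c
    ≡⟨ ++-assoc (Ns s) (E ∷ Es r) (N ∷ peakPathʳ c) ⟩
  Ns s ++ E ∷ Es r ++ N ∷ peakPathʳ c
    ∎

-- parseN s w: s N steps of the current block were read; parseE s r w: also E^{r+1}.
parseN : ℕ → List Step → Code
parseE : ℕ → ℕ → List Step → Code
parseN s []      = base 0 s
parseN s (N ∷ w) = parseN (suc s) w
parseN s (E ∷ w) = parseE s 0 w
parseE s r []      = base (suc r) s
parseE s r (E ∷ w) = parseE s (suc r) w
parseE s r (N ∷ w) = extend (parseN 0 w) r s

peakCode : List Step → Code
peakCode p = parseN 0 (reverse p)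

peakPathʳ-parseN : ∀ s w → peakPathʳ (parseN s w) ≡ Ns s ++ w
peakPathʳ-parseE : ∀ s r w → peakPathʳ (parseE s r w) ≡ Ns s ++ E ∷ Es r ++ w
peakPathʳ-parseN s []      = refl
peakPathʳ-parseN s (N ∷ w) = trans (peakPathʳ-parseN (suc s) w) (sym (replicate-++-∷ s N w))
peakPathʳ-parseN s (E ∷ w) = peakPathʳ-parseE s 0 w
peakPathʳ-parseE s r []      = cong (λ v → Ns s ++ E ∷ v) (sym (++-identityʳ (Es r)))
peakPathʳ-parseE s r (E ∷ w) =
  trans (peakPathʳ-parseE s (suc r) w) (cong (λ v → Ns s ++ E ∷ v) (sym (replicate-++-∷ r E w)))
peakPathʳ-parseE s r (N ∷ w) = cong (λ v → Ns s ++ E ∷ Es r ++ N ∷ v) (peakPathʳ-parseN 0 w)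

parseN-Ns-++ : ∀ t s w → parseN t (Ns s ++ w) ≡ parseN (s + t) w
parseN-Ns-++ t zero    w = refl
parseN-Ns-++ t (suc s) w = trans (parseN-Ns-++ (suc t) s w) (cong (λ k → parseN k w) (+-suc s t))

parseE-Es-++ : ∀ s t r w → parseE s t (Es r ++ w) ≡ parseE s (r + t) w
parseE-Es-++ s t zero    w = refl
parseE-Es-++ s t (suc r) w = trans (parseE-Es-++ s (suc t) r w) (cong (λ k → parseE s k w) (+-suc r t))

parseN-Es : ∀ s r → parseN s (Es r) ≡ base r s
parseN-Es s zero    = refl
parseN-Es s (suc r) = begin
  parseE s 0 (Es r)       ≡⟨ cong (parseE s 0) (++-identityʳ (Es r)) ⟨
  parseE s 0 (Es r ++ []) ≡⟨ parseE-Es-++ s 0 r [] ⟩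
  base (suc (r + 0)) s    ≡⟨ cong (λ k → base (suc k) s) (+-identityʳ r) ⟩
  base (suc r) s          ∎

parseN-peakPathʳ : ∀ c → parseN 0 (peakPathʳ c) ≡ c
parseN-peakPathʳ (base r s) = begin
  parseN 0 (Ns s ++ Es r) ≡⟨ parseN-Ns-++ 0 s (Es r) ⟩
  parseN (s + 0) (Es r)   ≡⟨ cong (λ k → parseN k (Es r)) (+-identityʳ s) ⟩
  parseN s (Es r)         ≡⟨ parseN-Es s r ⟩
  base r s                ∎
parseN-peakPathʳ (extend c r s) = begin
  parseN 0 (Ns s ++ E ∷ Es r ++ N ∷ peakPathʳ c)
    ≡⟨ parseN-Ns-++ 0 s (E ∷ Es r ++ N ∷ peakPathʳ c) ⟩
  parseN (s + 0) (E ∷ Es r ++ N ∷ peakPathʳ c)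
    ≡⟨ cong (λ k → parseN k (E ∷ Es r ++ N ∷ peakPathʳ c)) (+-identityʳ s) ⟩
  parseE s 0 (Es r ++ N ∷ peakPathʳ c)
    ≡⟨ parseE-Es-++ s 0 r (N ∷ peakPathʳ c) ⟩
  extend (parseN 0 (peakPathʳ c)) (r + 0) s
    ≡⟨ cong₂ (λ c′ k → extend c′ k s) (parseN-peakPathʳ c) (+-identityʳ r) ⟩
  extend c r s
    ∎

peakCode-peakPath : ∀ c → peakCode (peakPath c) ≡ c
peakCode-peakPath c = trans (cong (parseN 0) (reverse-peakPath c)) (parseN-peakPathʳ c)

peakPath-peakCode : ∀ p → peakPath (peakCode p) ≡ p
peakPath-peakCode p =
  reverse-injective (trans (reverse-peakPath (peakCode p)) (peakPathʳ-parseN 0 (reverse p)))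

splitAtLastN : List Step → ℕ ⊎ (List Step × ℕ)
splitAtLastN []      = inj₁ 0
splitAtLastN (E ∷ w) with splitAtLastN w
... | inj₁ k       = inj₁ (suc k)
... | inj₂ (u , r) = inj₂ (E ∷ u , r)
splitAtLastN (N ∷ w) with splitAtLastN w
... | inj₁ k       = inj₂ ([] , k)
... | inj₂ (u , r) = inj₂ (N ∷ u , r)

SplitsAtLastN : List Step → ℕ ⊎ (List Step × ℕ) → Set
SplitsAtLastN w (inj₁ k)       = Es k ≡ w
SplitsAtLastN w (inj₂ (u , r)) = u ++ N ∷ Es r ≡ w

splitAtLastN-correct : ∀ w → SplitsAtLastN w (splitAtLastN w)
splitAtLastN-correct []      = refl
splitAtLastN-correct (E ∷ w) with splitAtLastN w | splitAtLastN-correct w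
... | inj₁ k       | Es≡w   = cong (E ∷_) Es≡w
... | inj₂ (u , r) | split≡w = cong (E ∷_) split≡w
splitAtLastN-correct (N ∷ w) with splitAtLastN w | splitAtLastN-correct w
... | inj₁ k       | Es≡w   = cong (N ∷_) Es≡w
... | inj₂ (u , r) | split≡w = cong (N ∷_) split≡w

splitAtLastN-Es : ∀ r → splitAtLastN (Es r) ≡ inj₁ r
splitAtLastN-Es zero    = refl
splitAtLastN-Es (suc r) rewrite splitAtLastN-Es r = refl

splitAtLastN-++-N-Es : ∀ u r → splitAtLastN (u ++ N ∷ Es r) ≡ inj₂ (u , r)
splitAtLastN-++-N-Es []      r rewrite splitAtLastN-Es r = refl
splitAtLastN-++-N-Es (E ∷ u) r rewrite splitAtLastN-++-N-Es u r = refl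
splitAtLastN-++-N-Es (N ∷ u) r rewrite splitAtLastN-++-N-Es u r = refl

-- The recursive call is on the inner path u of Q = N^s E u N E^r, so the first argument is fuel,
-- a bound on the length of the input; the clause for empty fuel is never reached.
parseHook : ℕ → ℕ → List Step → Code
parseHookInner : ℕ → ℕ → ℕ ⊎ (List Step × ℕ) → Code
parseHook f       s []      = base 0 s
parseHook f       s (N ∷ w) = parseHook f (suc s) w
parseHook zero    s (E ∷ w) = base 0 0
parseHook (suc f) s (E ∷ w) = parseHookInner f s (splitAtLastN w)
parseHookInner f s (inj₁ r)       = base (suc r) s
parseHookInner f s (inj₂ (u , r)) = extend (parseHook f 0 u) r s

hookCode : List Step → Code
hookCode q = parseHook (length q) 0 q

hookPath-parseHook : ∀ f s w → length w ≤ f → hookPath (parseHook f s w) ≡ Ns s ++ w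
hookPath-parseHook f       s []      _ = refl
hookPath-parseHook f       s (N ∷ w) w≤f =
  trans (hookPath-parseHook f (suc s) w (≤-trans (n≤1+n (length w)) w≤f)) (sym (replicate-++-∷ s N w))
hookPath-parseHook (suc f) s (E ∷ w) (s≤s w≤f) with splitAtLastN w | splitAtLastN-correct w
... | inj₁ k       | Es≡w   = cong (λ v → Ns s ++ E ∷ v) Es≡w
... | inj₂ (u , r) | split≡w = cong (λ v → Ns s ++ E ∷ v)
  (trans (cong (_++ N ∷ Es r) (hookPath-parseHook f 0 u u≤f)) split≡w)
  where
  u≤f : length u ≤ f
  u≤f = ≤-trans (length-++-≤ˡ u) (≤-trans (≤-reflexive (cong length split≡w)) w≤f)

parseHook-Ns-++ : ∀ f t s w → parseHook f t (Ns s ++ w) ≡ parseHook f (s + t) w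
parseHook-Ns-++ f t zero    w = refl
parseHook-Ns-++ f t (suc s) w = trans (parseHook-Ns-++ f (suc t) s w) (cong (λ k → parseHook f k w) (+-suc s t))

parseHook-Ns-E : ∀ f s w → length (Ns s ++ E ∷ w) ≤ f →
  parseHook f 0 (Ns s ++ E ∷ w) ≡ parseHookInner (pred f) s (splitAtLastN w)
parseHook-Ns-E f s w len≤f = begin
  parseHook f 0 (Ns s ++ E ∷ w)              ≡⟨ parseHook-Ns-++ f 0 s (E ∷ w) ⟩
  parseHook f (s + 0) (E ∷ w)                ≡⟨ cong (λ k → parseHook f k (E ∷ w)) (+-identityʳ s) ⟩
  parseHook f s (E ∷ w)                      ≡⟨ unfold f (≤-trans (length-++-≤ʳ (E ∷ w) {Ns s}) len≤f) ⟩
  parseHookInner (pred f) s (splitAtLastN w) ∎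
  where
  unfold : ∀ f → length (E ∷ w) ≤ f → parseHook f s (E ∷ w) ≡ parseHookInner (pred f) s (splitAtLastN w)
  unfold (suc f) _ = refl

parseHook-hookPath : ∀ f c → length (hookPath c) ≤ f → parseHook f 0 (hookPath c) ≡ c
parseHook-hookPath f (base zero s) _ =
  trans (parseHook-Ns-++ f 0 s []) (cong (base 0) (+-identityʳ s))
parseHook-hookPath f (base (suc r) s) len≤f =
  trans (parseHook-Ns-E f s (Es r) len≤f) (cong (parseHookInner (pred f) s) (splitAtLastN-Es r))
parseHook-hookPath f (extend c r s) len≤f = begin
  parseHook f 0 (Ns s ++ E ∷ hookPath c ++ N ∷ Es r)
    ≡⟨ parseHook-Ns-E f s (hookPath c ++ N ∷ Es r) len≤f ⟩
  parseHookInner (pred f) s (splitAtLastN (hookPath c ++ N ∷ Es r))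
    ≡⟨ cong (parseHookInner (pred f) s) (splitAtLastN-++-N-Es (hookPath c) r) ⟩
  extend (parseHook (pred f) 0 (hookPath c)) r s
    ≡⟨ cong (λ c′ → extend c′ r s) (parseHook-hookPath (pred f) c inner≤) ⟩
  extend c r s
    ∎
  where
  inner≤ : length (hookPath c) ≤ pred f
  inner≤ = ≤-trans (length-++-≤ˡ (hookPath c))
    (pred-mono-≤ (≤-trans (length-++-≤ʳ (E ∷ hookPath c ++ N ∷ Es r) {Ns s}) len≤f))

hookCode-hookPath : ∀ c → hookCode (hookPath c) ≡ c
hookCode-hookPath c = parseHook-hookPath _ c ≤-refl

hookPath-hookCode : ∀ q → hookPath (hookCode q) ≡ q
hookPath-hookCode q = hookPath-parseHook _ 0 q ≤-refl

toHook fromHook : List Step → List Step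
toHook p   = hookPath (peakCode p)
fromHook q = peakPath (hookCode q)

fromHook-toHook : ∀ p → fromHook (toHook p) ≡ p
fromHook-toHook p = trans (cong peakPath (hookCode-hookPath (peakCode p))) (peakPath-peakCode p)

toHook-fromHook : ∀ q → toHook (fromHook q) ≡ q
toHook-fromHook q = trans (cong hookPath (peakCode-peakPath (hookCode q))) (hookPath-hookCode q)

via-peakCode : (R : List Step → List Step → Set) → (∀ c → R (peakPath c) (hookPath c)) → ∀ p → R p (toHook p)
via-peakCode R R-code p = subst (λ p′ → R p′ (toHook p)) (peakPath-peakCode p) (R-code (peakCode p))

Y-≡ : ∀ {a b} {P Q : Y a b} → proj₁ P ≡ proj₁ Q → P ≡ Q
Y-≡ {P = p , eN , eE} {Q = .p , eN′ , eE′} refl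
  rewrite ≡-irrelevant eN eN′ | ≡-irrelevant eE eE′ = refl

Y-⤖ : ∀ {a b} (f g : List Step → List Step) →
      (∀ p → countN (f p) ≡ countN p) → (∀ p → countE (f p) ≡ countE p) →
      (∀ p → g (f p) ≡ p) → (∀ q → f (g q) ≡ q) → Y a b ⤖ Y a b
Y-⤖ {a} {b} f g countN-f countE-f gf≗id fg≗id =
  ↔⇒⤖ (mk↔ₛ′ to from (λ Q → Y-≡ (fg≗id (proj₁ Q))) (λ P → Y-≡ (gf≗id (proj₁ P))))
  where
  countN-g : ∀ q → countN (g q) ≡ countN q
  countN-g q = trans (sym (countN-f (g q))) (cong countN (fg≗id q))
  countE-g : ∀ q → countE (g q) ≡ countE q
  countE-g q = trans (sym (countE-f (g q))) (cong countE (fg≗id q))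
  to from : Y a b → Y a b
  to   (p , eN , eE) = f p , trans (countN-f p) eN , trans (countE-f p) eE
  from (q , eN , eE) = g q , trans (countN-g q) eN , trans (countE-g q) eE

∈Peak*⇔∈hd* : ∀ {p q} → Peak p ≐ hd q → length p ≡ length q → last p ≡ head q →
              ∀ i → (i ∈Peak* p) ⇔ (i ∈hd* q)
∈Peak*⇔∈hd* {p} {q} Peak≐hd′ length≡ last≡head i = mk⇔ to from
  where
  to : i ∈Peak* p → i ∈hd* q
  to (inj₁ i∈Peak)         = inj₁ (Equivalence.to (Peak≐hd′ i) i∈Peak)
  to (inj₂ (i≡n , endsN))  = inj₂ (trans i≡n length≡ , trans (sym last≡head) endsN)
  from : i ∈hd* q → i ∈Peak* p
  from (inj₁ i∈hd)         = inj₁ (Equivalence.from (Peak≐hd′ i) i∈hd)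
  from (inj₂ (i≡n , begN)) = inj₂ (trans i≡n (sym length≡) , trans last≡head begN)

lemma4p1 : (a b : ℕ) → Σ (Y a b ⤖ Y a b) (λ g → (P : Y a b) →
             (Peak (proj₁ P) ≐ hd (proj₁ (Bijection.to g P)))
             × (∀ i → (i ∈Peak* proj₁ P) ⇔ (i ∈hd* proj₁ (Bijection.to g P))))
lemma4p1 a b = Y-⤖ toHook fromHook countN-toHook countE-toHook fromHook-toHook toHook-fromHook
             , λ (p , _) → Peak≐hd-toHook p , Peak*⇔hd*-toHook p
  where
  countN-toHook : ∀ p → countN (toHook p) ≡ countN p
  countN-toHook = via-peakCode (λ p q → countN q ≡ countN p) (additive-hookPath countN countN-++)
  countE-toHook : ∀ p → countE (toHook p) ≡ countE p
  countE-toHook = via-peakCode (λ p q → countE q ≡ countE p) (additive-hookPath countE countE-++)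
  Peak≐hd-toHook : ∀ p → Peak p ≐ hd (toHook p)
  Peak≐hd-toHook = via-peakCode (λ p q → Peak p ≐ hd q) Peak≐hd
  Peak*⇔hd*-toHook : ∀ p i → (i ∈Peak* p) ⇔ (i ∈hd* toHook p)
  Peak*⇔hd*-toHook = via-peakCode (λ p q → ∀ i → (i ∈Peak* p) ⇔ (i ∈hd* q)) λ c →
    ∈Peak*⇔∈hd* {peakPath c} (Peak≐hd c) (sym (length-hookPath c)) (last-peakPath c)
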